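{- Let $n$ be even and let $G$ be a collection of $n/2$ vertex-disjoint directed 2-cycles on the vertex set $[n]$, and let $\pi$ be the fixed-point-free involution of $[n]$ represented by $G$. Then ${\sf cut}(\pi)\le {\sf near}(G)$.
   Context: A collection of vertex-disjoint 2-cycles $(a_1,b_1),\ldots,(a_{n/2},b_{n/2})$ covering $[n]$ (each 2-cycle consisting of the edges $a_i\to b_i$ and $b_i\to a_i$, possibly together with self loops at the vertices) represents the involution $\pi=(a_1\,b_1)\cdots(a_{n/2}\,b_{n/2})$. For $1\le i\le n$, the cut at $i$, $C_i(\pi)$, is the set of 2-cycles (transpositions) $\{j,\pi(j)\}$ of $\pi$ with $\min(j,\pi(j))\le i\le \max(j,\pi(j))$, and ${\sf cut}(\pi)=\max_{1\le k\le n}|C_k(\pi)|$. The strongly connected components of $G$ are the pairs $\{a_i,b_i\}$; for such a component $C$, ${\sf near}(C)=\max_{i,j\in C}|i-j|$, and ${\sf near}(G)=\max_C{\sf near}(C)$. -}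

module Defs where

open import Data.Nat using (ℕ; _⊔_; _∸_; _≤_; _<_; _<?_; _≤?_)
open import Data.Fin using (Fin; toℕ)
open import Data.List using (List; []; _∷_; map; length; filter; foldr; concatMap)
open import Data.List.Base using (allFin)
open import Data.Product using (_×_; _,_; proj₁; proj₂)
open import Relation.Nullary.Decidable using (_×-dec_)

-- Vertices of [n] are modelled by Fin n (0-based; all notions below are
-- translation invariant).  A 2-cycle (a , b) stands for edges a→b, b→a.
TwoCycles : ℕ → Set
TwoCycles n = List (Fin n × Fin n)

vertices : ∀ {n} → TwoCycles n → List (Fin n)
vertices = concatMap (λ p → proj₁ p ∷ proj₂ p ∷ [])

dist : ℕ → ℕ → ℕ
dist i j = (i ∸ j) ⊔ (j ∸ i)

nearC : ∀ {n} → Fin n × Fin n → ℕ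
nearC (a , b) = dist (toℕ a) (toℕ b)

near : ∀ {n} → TwoCycles n → ℕ
near G = foldr (λ p m → nearC p ⊔ m) 0 G

-- |C_k(π)|: the transpositions {j, π j} with min ≤ k ≤ max, each counted
-- once via its smaller element j (j < π j).
cutAt : ∀ {n} → (Fin n → Fin n) → Fin n → ℕ
cutAt π k = length (filter (λ j → (toℕ j <? toℕ (π j)) ×-dec ((toℕ j ≤? toℕ k) ×-dec (toℕ k ≤? toℕ (π j)))) (allFin _))

cut : ∀ {n} → (Fin n → Fin n) → ℕ
cut π = foldr (λ k m → cutAt π k ⊔ m) 0 (allFin _)

module Submission where

-- Write D = near(G).  Every vertex lies in exactly one 2-cycle
-- of G, so π is an involution and every vertex is moved by at most D:
-- π j ≤ j + D.  A transposition {j, π j} with j < π j lies in the cut at k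
-- ("crosses k") only if k - D ≤ j ≤ k, a window of D + 1 positions.  One
-- endpoint of the window is always wasted: if k itself crosses k and so
-- does j = k - D, then π j = k forces π k = j ≤ k, contradicting k < π k.
-- Hence at most D positions remain, and |C_k(π)| ≤ D for every k.

open import Defs
open import Data.Nat using (ℕ; _*_; _≤_)
open import Data.Fin using (Fin)
open import Data.List using (length)
open import Data.List.Membership.Propositional using (_∈_)
open import Data.List.Relation.Unary.Unique.Propositional using (Unique)
open import Data.Product using (_×_; _,_)
open import Relation.Binary.PropositionalEquality using (_≡_)

open import Data.Nat using (suc; _+_; _∸_; _⊔_; _<_; z≤n; s≤s; _≤?_; _<?_)
open import Data.Nat.Properties
open import Data.Fin using (toℕ)
open import Data.Fin.Properties using (toℕ-injective)
open import Data.List using (List; []; _∷_; filter; foldr; allFin)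
open import Data.List.Relation.Unary.All using (All; []; _∷_)
import Data.List.Relation.Unary.All as All
open import Data.List.Relation.Unary.All.Properties using (all-filter)
open import Data.List.Relation.Unary.AllPairs using (AllPairs; []; _∷_)
import Data.List.Relation.Unary.AllPairs.Properties as AllPairs
open import Data.List.Relation.Unary.Any using (here; there)
open import Data.Product using (∃; proj₁; proj₂)
open import Data.Sum using (_⊎_; inj₁; inj₂)
open import Function using (_∘_)
open import Relation.Nullary using (yes; no)
open import Relation.Nullary.Decidable using (_×-dec_)
open import Relation.Unary using (Pred; Decidable)
open import Relation.Binary.PropositionalEquality using (_≢_; refl; sym; trans; cong; subst)

ascending-window-length : ∀ {a} {A : Set a} (key : A → ℕ) {lo hi : ℕ} {xs : List A}
  → AllPairs (λ x y → key x < key y) xs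
  → All (λ x → lo ≤ key x) xs → All (λ x → key x < hi) xs
  → length xs ≤ hi ∸ lo
ascending-window-length key [] [] [] = z≤n
ascending-window-length key {lo} {hi} {x ∷ xs} (x<xs ∷ ascending) (lo≤x ∷ _) (x<hi ∷ xs<hi) = begin
  suc (length xs)         ≤⟨ s≤s (ascending-window-length key ascending x<xs xs<hi) ⟩
  suc (hi ∸ suc (key x))  ≡⟨ sym (+-∸-assoc 1 x<hi) ⟩
  hi ∸ key x              ≤⟨ ∸-monoʳ-≤ hi lo≤x ⟩
  hi ∸ lo                 ∎
  where open ≤-Reasoning

count-in-window : ∀ {n p} {P : Pred (Fin n) p} (P? : Decidable P) (lo hi : ℕ)
  → (∀ {j} → P j → lo ≤ toℕ j × toℕ j < hi)
  → length (filter P? (allFin n)) ≤ hi ∸ lo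
count-in-window P? lo hi inWindow =
  ascending-window-length toℕ
    (AllPairs.filter⁺ P? (AllPairs.tabulate⁺-< (λ i<j → i<j)))
    (All.map (proj₁ ∘ inWindow) satisfied)
    (All.map (proj₂ ∘ inWindow) satisfied)
  where satisfied = all-filter P? (allFin _)

module WindowBound {n : ℕ} (π : Fin n → Fin n) (D : ℕ)
  (involutive : ∀ j → π (π j) ≡ j)
  (displacement : ∀ j → toℕ (π j) ≤ toℕ j + D) where

  Crosses : Fin n → Fin n → Set
  Crosses k j = toℕ j < toℕ (π j) × (toℕ j ≤ toℕ k × toℕ k ≤ toℕ (π j))

  crosses? : ∀ k → Decidable (Crosses k)
  crosses? k j = (toℕ j <? toℕ (π j)) ×-dec ((toℕ j ≤? toℕ k) ×-dec (toℕ k ≤? toℕ (π j)))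

  crosser-near : ∀ {k j} → Crosses k j → toℕ k ∸ D ≤ toℕ j
  crosser-near {k} {j} (_ , _ , k≤πj) =
    m≤n+o⇒m∸n≤o (toℕ k) D (≤-trans k≤πj (≤-trans (displacement j) (≤-reflexive (+-comm (toℕ j) D))))

  far-end-excluded : ∀ {k j} → D ≤ toℕ k → Crosses k k → Crosses k j → toℕ j ≢ toℕ k ∸ D
  far-end-excluded {k} {j} D≤k (k<πk , _) (_ , j≤k , k≤πj) j≡k-D = <⇒≱ k<πk πk≤k
    where
      πj≤k : toℕ (π j) ≤ toℕ k
      πj≤k = ≤-trans (displacement j)
               (≤-reflexive (trans (cong (_+ D) j≡k-D) (m∸n+n≡m D≤k)))
      πk≡j : π k ≡ j
      πk≡j = trans (cong π (sym (toℕ-injective (≤-antisym πj≤k k≤πj)))) (involutive j)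
      πk≤k : toℕ (π k) ≤ toℕ k
      πk≤k = subst (λ v → toℕ v ≤ toℕ k) (sym πk≡j) j≤k

  cutAt-bound : ∀ k → cutAt π k ≤ D
  cutAt-bound k with toℕ k <? D | crosses? k k
  ... | yes k<D | _ =
    ≤-trans (count-in-window (crosses? k) 0 (suc (toℕ k)) (λ c → z≤n , s≤s (proj₁ (proj₂ c)))) k<D
  ... | no k≮D | no k-stays =
    subst (cutAt π k ≤_) (m∸[m∸n]≡n (≮⇒≥ k≮D))
      (count-in-window (crosses? k) (toℕ k ∸ D) (toℕ k) (λ c → crosser-near c , left-of-k c))
    where
      left-of-k : ∀ {j} → Crosses k j → toℕ j < toℕ k
      left-of-k {j} c@(_ , j≤k , _) =
        ≤∧≢⇒< j≤k (λ j≡k → k-stays (subst (Crosses k) (toℕ-injective j≡k) c))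
  ... | no k≮D | yes k-crosses =
    subst (cutAt π k ≤_) (m∸[m∸n]≡n (≮⇒≥ k≮D))
      (count-in-window (crosses? k) (suc (toℕ k ∸ D)) (suc (toℕ k))
        (λ c → right-of-far-end c , s≤s (proj₁ (proj₂ c))))
    where
      right-of-far-end : ∀ {j} → Crosses k j → toℕ k ∸ D < toℕ j
      right-of-far-end c =
        ≤∧≢⇒< (crosser-near c) (far-end-excluded (≮⇒≥ k≮D) k-crosses c ∘ sym)

cut-bound : ∀ {n} (π : Fin n → Fin n) (D : ℕ) → (∀ k → cutAt π k ≤ D) → cut π ≤ D
cut-bound π D bounded = go (allFin _)
  where
    go : (ks : List (Fin _)) → foldr (λ k m → cutAt π k ⊔ m) 0 ks ≤ D
    go [] = z≤n
    go (k ∷ ks) = ⊔-lub (bounded k) (go ks)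

partner : ∀ {n} (G : TwoCycles n) v → v ∈ vertices G → ∃ λ b → (v , b) ∈ G ⊎ (b , v) ∈ G
partner ((a , b) ∷ G) v (here refl) = b , inj₁ (here refl)
partner ((a , b) ∷ G) v (there (here refl)) = a , inj₂ (here refl)
partner (c ∷ G) v (there (there v∈G)) with partner G v v∈G
... | b , inj₁ vb∈G = b , inj₁ (there vb∈G)
... | b , inj₂ bv∈G = b , inj₂ (there bv∈G)

nearC≤near : ∀ {n} (G : TwoCycles n) {c} → c ∈ G → nearC c ≤ near G
nearC≤near (c ∷ G) (here refl) = m≤m⊔n (nearC c) (near G)
nearC≤near (c ∷ G) (there c∈G) = ≤-trans (nearC≤near G c∈G) (m≤n⊔m (nearC c) (near G))

≤+dist : ∀ i j → j ≤ i + dist i j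
≤+dist i j = ≤-trans (m≤n+m∸n j i) (+-monoʳ-≤ i (m≤n⊔m (i ∸ j) (j ∸ i)))

module FromTwoCycles {n : ℕ} (G : TwoCycles n) (covers : ∀ v → v ∈ vertices G)
  (π : Fin n → Fin n) (represents : ∀ a b → (a , b) ∈ G → π a ≡ b × π b ≡ a) where

  involutive : ∀ j → π (π j) ≡ j
  involutive j with partner G j (covers j)
  ... | b , inj₁ jb∈G = trans (cong π (proj₁ (represents j b jb∈G))) (proj₂ (represents j b jb∈G))
  ... | b , inj₂ bj∈G = trans (cong π (proj₂ (represents b j bj∈G))) (proj₁ (represents b j bj∈G))

  moved-within-near : ∀ j → dist (toℕ j) (toℕ (π j)) ≤ near G
  moved-within-near j with partner G j (covers j)
  ... | b , inj₁ jb∈G rewrite proj₁ (represents j b jb∈G) = nearC≤near G jb∈G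
  ... | b , inj₂ bj∈G rewrite proj₂ (represents b j bj∈G) =
    ≤-trans (≤-reflexive (⊔-comm (toℕ j ∸ toℕ b) (toℕ b ∸ toℕ j))) (nearC≤near G bj∈G)

  displacement : ∀ j → toℕ (π j) ≤ toℕ j + near G
  displacement j = ≤-trans (≤+dist (toℕ j) (toℕ (π j))) (+-monoʳ-≤ (toℕ j) (moved-within-near j))

lemma1 : (m : ℕ) → (G : TwoCycles (2 * m)) → length G ≡ m
       → Unique (vertices G) → (∀ v → v ∈ vertices G)
       → (π : Fin (2 * m) → Fin (2 * m))
       → (∀ a b → (a , b) ∈ G → π a ≡ b × π b ≡ a)
       → cut π ≤ near G
lemma1 m G _ _ covers π represents =
  cut-bound π (near G) (WindowBound.cutAt-bound π (near G) involutive displacement)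
  where open FromTwoCycles G covers π represents
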